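{- Let $N\in\mathbb{N}$, let $\mathcal{T}$ be an $N$-regular rooted tree, let $\mathcal{S}\subset\mathcal{T}$ be a subtree, and let $1\le m\le N$ be an integer. Suppose that for every $m$-regular subtree $\mathcal{R}$ of $\mathcal{T}$, the set $\mathcal{S}\cap\mathcal{R}$ is infinite. Then $\mathcal{S}$ has an $(N-m+1)$-regular subtree.
   Context: A rooted tree is a connected graph without cycles with a distinguished vertex $\tau_0$ (the root); it is identified with its vertex set. The height of a vertex is the length of the unique path from it to the root. A vertex $\tau$ is a successor of $\tau'$ if $\tau'$ lies on the path from $\tau$ to the root and the height of $\tau$ is one more than that of $\tau'$. A subtree of $\mathcal{T}$ is a subset of vertices that forms a rooted tree with the same root $\tau_0$ (i.e. a subset containing $\tau_0$ and closed under taking predecessors), with the induced successor relation. A rooted tree is $N$-regular if every vertex has exactly $N$ successors. -}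

module Defs where

open import Data.Nat using (ℕ)
open import Data.Fin using (Fin)
open import Data.List using (List; []; _∷_)
open import Data.List.Membership.Propositional using (_∈_)
open import Data.Product using (Σ; _×_; ∃)
open import Relation.Binary.PropositionalEquality using (_≡_)
open import Relation.Nullary using (¬_)
open import Function.Definitions using (Injective)
open import Level using (0ℓ)
open import Relation.Unary using (Pred; _⊆_; _∩_)

-- The root is [], and the successors of a vertex v are the words i ∷ v
-- (i : Fin N); so the predecessor of i ∷ v is v and the height of v is
-- its length.  Every N-regular rooted tree is isomorphic to this one.
Vertex : ℕ → Set
Vertex N = List (Fin N)

root : ∀ {N} → Vertex N
root = []

VSet : ℕ → Set₁
VSet N = Pred (Vertex N) 0ℓ

IsSubtree : ∀ {N} → VSet N → Set
IsSubtree {N} S = S root × (∀ (i : Fin N) (v : Vertex N) → S (i ∷ v) → S v)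

HasExactlySuccessors : ∀ {N} → VSet N → ℕ → Vertex N → Set
HasExactlySuccessors {N} R k v =
  Σ (Fin k → Fin N) λ f →
    Injective _≡_ _≡_ f
    × (∀ j → R (f j ∷ v))
    × (∀ i → R (i ∷ v) → ∃ λ j → f j ≡ i)

IsRegularSubtree : ∀ {N} → ℕ → VSet N → Set
IsRegularSubtree k R = IsSubtree R × (∀ v → R v → HasExactlySuccessors R k v)

IsFinite : ∀ {N} → VSet N → Set
IsFinite {N} A = Σ (List (Vertex N)) λ xs → ∀ v → A v → v ∈ xs

IsInfinite : ∀ {N} → VSet N → Set
IsInfinite A = ¬ IsFinite A

module Submission where

-- Call a vertex v of the N-regular tree m-large for S if the
-- part of S above v (re-rooted at v) meets every m-regular subtree in an
-- infinite set.  By hypothesis the root is m-large, and (classically) every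
-- m-large vertex lies in S.  The heart of the argument: an m-large vertex has
-- at least N - m + 1 m-large successors.  Otherwise, colouring its N
-- successors by largeness, m of them are not large; each comes with an
-- m-regular witness meeting S in a finite set, and grafting these m witnesses
-- onto v yields an m-regular subtree meeting S above v in a finite set.
-- Finally, a predicate that holds at the root and has k distinct successors
-- at each vertex where it holds contains a k-regular subtree.

open import Defs
open import Data.Nat using (ℕ; zero; suc; pred; _≤_; _<_; _∸_; _+_)
open import Data.Nat.Properties using (m∸n+n≡m; +-suc; +-assoc)
open import Data.Fin using (Fin; inject≤; fromℕ<; toℕ) renaming (zero to fzero; suc to fsuc)
open import Data.Fin.Properties using (toℕ-inject≤; toℕ-fromℕ<; toℕ-injective; toℕ<n; suc-injective)
open import Data.List using (List; []; _∷_; _++_; _∷ʳ_; map; concat; allFin)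
open import Data.List.Properties using (∷ʳ-injective; ∷-injective; ++-assoc; ++-identityʳ)
open import Data.List.Membership.Propositional using (_∈_)
open import Data.List.Membership.Propositional.Properties using (∈-concat⁺′; ∈-map⁺; ∈-allFin)
open import Data.List.Relation.Unary.Any using (here; there)
open import Data.List.Relation.Unary.All using (All; []; _∷_)
open import Data.Product using (Σ; _×_; _,_; proj₁; proj₂; ∃)
open import Data.Sum as Sum using (_⊎_; inj₁; inj₂)
open import Data.Unit using (⊤; tt)
open import Data.Empty using (⊥-elim)
open import Relation.Nullary using (¬_; yes; no)
open import Relation.Binary.PropositionalEquality using (_≡_; refl; sym; trans; cong; subst)
open import Relation.Unary using (Pred; _⊆_; _∩_)
open import Function.Definitions using (Injective)
open import Axiom.ExcludedMiddle using (ExcludedMiddle)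

Distinct : ∀ {ℓ n} → ℕ → (Fin n → Set ℓ) → Set ℓ
Distinct {n = n} a P = Σ (Fin a → Fin n) λ f → Injective _≡_ _≡_ f × (∀ j → P (f j))

distinct-none : ∀ {ℓ n} {P : Fin n → Set ℓ} → Distinct 0 P
distinct-none = (λ ()) , (λ { {()} }) , (λ ())

distinct-shift : ∀ {ℓ n a} {P : Fin (suc n) → Set ℓ} →
                 Distinct a (λ i → P (fsuc i)) → Distinct a P
distinct-shift (f , f-inj , f-P) = (λ j → fsuc (f j)) , (λ eq → f-inj (suc-injective eq)) , f-P

distinct-extend : ∀ {ℓ n a} {P : Fin (suc n) → Set ℓ} →
                  P fzero → Distinct a (λ i → P (fsuc i)) → Distinct (suc a) P
distinct-extend {P = P} p (f , f-inj , f-P) = f′ , f′-inj , f′-P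
  where
    f′ : Fin (suc _) → Fin (suc _)
    f′ fzero    = fzero
    f′ (fsuc j) = fsuc (f j)

    f′-inj : Injective _≡_ _≡_ f′
    f′-inj {fzero}  {fzero}  _  = refl
    f′-inj {fzero}  {fsuc _} ()
    f′-inj {fsuc _} {fzero}  ()
    f′-inj {fsuc x} {fsuc y} eq = cong fsuc (f-inj (suc-injective eq))

    f′-P : ∀ j → P (f′ j)
    f′-P fzero    = p
    f′-P (fsuc j) = f-P j

colouring : ∀ {ℓ} n a b → a + b ≡ suc n → (P Q : Fin n → Set ℓ) →
            (∀ i → P i ⊎ Q i) → Distinct a P ⊎ Distinct b Q
colouring n zero b _ P Q _ = inj₁ (distinct-none {P = P})
colouring n (suc a) zero _ P Q _ = inj₂ (distinct-none {P = Q})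
colouring zero (suc a) (suc b) e P Q _ with trans (sym (+-suc a b)) (cong pred e)
... | ()
colouring (suc n) (suc a) (suc b) e P Q colour with colour fzero
... | inj₁ p = Sum.map (distinct-extend {P = P} p) (distinct-shift {P = Q})
                 (colouring n a (suc b) (cong pred e) (λ i → P (fsuc i)) (λ i → Q (fsuc i)) (λ i → colour (fsuc i)))
... | inj₂ q = Sum.map (distinct-shift {P = P}) (distinct-extend {P = Q} q)
                 (colouring n (suc a) b (trans (sym (+-suc a b)) (cong pred e))
                   (λ i → P (fsuc i)) (λ i → Q (fsuc i)) (λ i → colour (fsuc i)))

_at_ : ∀ {N} → VSet N → Vertex N → VSet N
(S at v) w = S (w ++ v)

subtree-suffix : ∀ {N} {S : VSet N} → IsSubtree S → ∀ w v → S (w ++ v) → S v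
subtree-suffix S-subtree []      v s = s
subtree-suffix S-subtree (i ∷ w) v s = subtree-suffix S-subtree w v (proj₂ S-subtree i (w ++ v) s)

snoc≢[] : ∀ {N} (u : Vertex N) i → ¬ (u ∷ʳ i ≡ [])
snoc≢[] []      i ()
snoc≢[] (_ ∷ _) i ()

finite-mono : ∀ {N} {A B : VSet N} → A ⊆ B → IsFinite B → IsFinite A
finite-mono A⊆B (xs , B⊆xs) = xs , λ v a → B⊆xs v (A⊆B a)

canonical : ∀ {N} m → VSet N
canonical m w = All (λ i → toℕ i < m) w

canonical-regular : ∀ {N m} → m ≤ N → IsRegularSubtree m (canonical {N} m)
canonical-regular {N} {m} m≤N = ([] , λ { i v (_ ∷ c) → c }) , successors
  where
    embed : Fin m → Fin N
    embed j = inject≤ j m≤N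

    embed-inj : Injective _≡_ _≡_ embed
    embed-inj {x} {y} eq =
      toℕ-injective (trans (sym (toℕ-inject≤ x m≤N)) (trans (cong toℕ eq) (toℕ-inject≤ y m≤N)))

    successors : ∀ v → canonical m v → HasExactlySuccessors (canonical m) m v
    successors v c =
      embed , embed-inj ,
      (λ j → subst (_< m) (sym (toℕ-inject≤ j m≤N)) (toℕ<n j) ∷ c) ,
      λ { i (i<m ∷ _) → fromℕ< i<m , toℕ-injective (trans (toℕ-inject≤ (fromℕ< i<m) m≤N) (toℕ-fromℕ< i<m)) }

-- Grafting: given k distinct letters g j and k-regular subtrees T j, the set
-- consisting of the root and the vertices u ∷ʳ g j with u ∈ T j (i.e. a copy
-- of T j hung above the successor g j of the root) is again k-regular.
module Graft {N k : ℕ} (g : Fin k → Fin N) (g-inj : Injective _≡_ _≡_ g) (T : Fin k → VSet N) where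

  graft : VSet N
  graft w = w ≡ [] ⊎ Σ (Fin k) λ j → Σ (Vertex N) λ u → w ≡ u ∷ʳ g j × T j u

  graft-above : ∀ i j u → graft (i ∷ (u ∷ʳ g j)) → T j (i ∷ u)
  graft-above i j u (inj₂ (j′ , [] , eq , _)) = ⊥-elim (snoc≢[] u (g j) (proj₂ (∷-injective eq)))
  graft-above i j u (inj₂ (j′ , i′ ∷ u′ , eq , t))
    with refl , eq′ ← ∷-injective eq
    with refl , gj≡gj′ ← ∷ʳ-injective u u′ eq′
    with refl ← g-inj gj≡gj′ = t

  graft-root-successor : ∀ i → graft (i ∷ []) → ∃ λ j → g j ≡ i
  graft-root-successor i (inj₂ (j , [] , refl , _)) = j , refl
  graft-root-successor i (inj₂ (j , _ ∷ u , eq , _)) = ⊥-elim (snoc≢[] u (g j) (sym (proj₂ (∷-injective eq))))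

  graft-regular : (∀ j → IsRegularSubtree k (T j)) → IsRegularSubtree k graft
  graft-regular T-reg = (inj₁ refl , closed) , successors
    where
      closed : ∀ i w → graft (i ∷ w) → graft w
      closed i w (inj₂ (j , [] , refl , _))     = inj₁ refl
      closed i w (inj₂ (j , i′ ∷ u , refl , t)) = inj₂ (j , u , refl , proj₂ (proj₁ (T-reg j)) i′ u t)

      successors : ∀ w → graft w → HasExactlySuccessors graft k w
      successors w (inj₁ refl) =
        g , g-inj , (λ j → inj₂ (j , [] , refl , proj₁ (proj₁ (T-reg j)))) , graft-root-successor
      successors w (inj₂ (j , u , refl , t)) with proj₂ (T-reg j) u t
      ... | f , f-inj , f-T , f-onto =
        f , f-inj , (λ l → inj₂ (j , f l ∷ u , refl , f-T l)) , λ i t′ → f-onto i (graft-above i j u t′)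

  graft-finite : (A : VSet N) → (∀ j → IsFinite (λ u → A (u ∷ʳ g j) × T j u)) → IsFinite (A ∩ graft)
  graft-finite A fin = [] ∷ concat (map copy (allFin k)) , covered
    where
      copy : Fin k → List (Vertex N)
      copy j = map (_∷ʳ g j) (proj₁ (fin j))

      covered : ∀ w → (A ∩ graft) w → w ∈ [] ∷ concat (map copy (allFin k))
      covered w (_ , inj₁ refl) = here refl
      covered w (a , inj₂ (j , u , refl , t)) =
        there (∈-concat⁺′ (∈-map⁺ (_∷ʳ g j) (proj₂ (fin j) u (a , t))) (∈-map⁺ copy (∈-allFin j)))

Large : ∀ {N} → ℕ → VSet N → Vertex N → Set₁
Large k S v = ∀ T → IsRegularSubtree k T → IsInfinite ((S at v) ∩ T)

large-root : ∀ {N k} {S : VSet N} →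
             (∀ T → IsRegularSubtree k T → IsInfinite (S ∩ T)) → Large k S root
large-root {S = S} hyp T T-reg fin = hyp T T-reg (finite-mono (λ {w} (s , t) → subst S (sym (++-identityʳ w)) s , t) fin)

module _ (lem : ∀ {ℓ} → ExcludedMiddle ℓ) {N : ℕ} {S : VSet N} where

  -- Outside S, the part of S above v is empty, so v is not large.
  large⇒member : IsSubtree S → ∀ {m} → m ≤ N → ∀ {v} → Large m S v → S v
  large⇒member S-subtree m≤N {v} large with lem {P = S v}
  ... | yes s = s
  ... | no ¬s = ⊥-elim (large _ (canonical-regular m≤N)
                          ([] , λ w (s , _) → ⊥-elim (¬s (subtree-suffix S-subtree w v s))))

  small-witness : ∀ {k v} → ¬ Large k S v →
                  Σ (VSet N) λ T → IsRegularSubtree k T × IsFinite ((S at v) ∩ T)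
  small-witness {k} {v} ¬large with lem {P = Σ (VSet N) λ T → IsRegularSubtree k T × IsFinite ((S at v) ∩ T)}
  ... | yes witness = witness
  ... | no ¬witness = ⊥-elim (¬large λ T T-reg fin → ¬witness (T , T-reg , fin))

  -- A k-large vertex cannot have k distinct successors that are not k-large:
  -- grafting their witnesses would give a k-regular subtree meeting S above
  -- v finitely.
  large-few-small-successors : ∀ {k v} → Large k S v → ¬ Distinct k (λ i → ¬ Large k S (i ∷ v))
  large-few-small-successors {k} {v} large (g , g-inj , small) =
    large graft (graft-regular (λ j → proj₁ (proj₂ (witness j))))
      (graft-finite (S at v) λ j → finite-mono (reassociate j) (proj₂ (proj₂ (witness j))))
    where
      witness : ∀ j → Σ (VSet N) λ T → IsRegularSubtree k T × IsFinite ((S at (g j ∷ v)) ∩ T)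
      witness j = small-witness (small j)

      open Graft g g-inj (λ j → proj₁ (witness j))

      reassociate : ∀ j {u} → (S at v) (u ∷ʳ g j) × proj₁ (witness j) u →
                    ((S at (g j ∷ v)) ∩ proj₁ (witness j)) u
      reassociate j {u} (s , t) = subst S (++-assoc u (g j ∷ []) v) s , t

  large-successors : ∀ {k k′ v} → k′ + k ≡ suc N → Large k S v → Distinct k′ (λ i → Large k S (i ∷ v))
  large-successors {k} {k′} {v} total large
    with colouring N k′ k total (λ i → Large k S (i ∷ v)) (λ i → ¬ Large k S (i ∷ v)) decide
    where
      decide : ∀ i → Large k S (i ∷ v) ⊎ ¬ Large k S (i ∷ v)
      decide i with lem {P = Large k S (i ∷ v)}
      ... | yes l = inj₁ l
      ... | no ¬l = inj₂ ¬l
  ... | inj₁ many-large = many-large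
  ... | inj₂ many-small = ⊥-elim (large-few-small-successors large many-small)

-- The subtree follows a fixed choice
-- of k successors at every vertex (the root's choice serving as a dummy
-- outside P, where excluded middle decides membership).
branching⇒regular-subtree :
  (lem : ∀ {ℓ} → ExcludedMiddle ℓ) → ∀ {ℓ N k} (P : Pred (Vertex N) ℓ) → P root →
  (∀ v → P v → Distinct k (λ i → P (i ∷ v))) →
  Σ (VSet N) λ R → R ⊆ P × IsRegularSubtree k R
branching⇒regular-subtree lem {ℓ} {N} {k} P P-root branching = R , R⊆P , (tt , λ i v r → proj₁ r) , successors
  where
    choice : ∀ v → Σ (Fin k → Fin N) λ f → Injective _≡_ _≡_ f × (P v → ∀ j → P (f j ∷ v))
    choice v with lem {P = P v}
    ... | yes p = let f , f-inj , f-P = branching v p in f , f-inj , λ _ → f-P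
    ... | no ¬p = let f , f-inj , _ = branching root P-root in f , f-inj , λ p → ⊥-elim (¬p p)

    R : VSet N
    R []      = ⊤
    R (i ∷ v) = R v × ∃ λ j → proj₁ (choice v) j ≡ i

    R⊆P : R ⊆ P
    R⊆P {[]}    _             = P-root
    R⊆P {i ∷ v} (r , j , refl) = proj₂ (proj₂ (choice v)) (R⊆P r) j

    successors : ∀ v → R v → HasExactlySuccessors R k v
    successors v r = proj₁ (choice v) , proj₁ (proj₂ (choice v)) , (λ j → r , j , refl) , λ i r′ → proj₂ r′

-- The theorem: the set of m-large vertices lies in S, contains the root and
-- branches (N - m + 1)-fold, so it contains an (N - m + 1)-regular subtree.
proposition2p1 : (lem : ∀ {ℓ} → ExcludedMiddle ℓ)
    (N : ℕ) (S : VSet N) → IsSubtree S →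
    (m : ℕ) → 1 ≤ m → m ≤ N →
    (∀ (R : VSet N) → IsRegularSubtree m R → IsInfinite (S ∩ R)) →
    Σ (VSet N) λ R → R ⊆ S × IsRegularSubtree (N ∸ m + 1) R
proposition2p1 lem N S S-subtree m _ m≤N hyp =
  let R , R⊆large , R-regular =
        branching⇒regular-subtree lem (Large m S) (large-root hyp)
          (λ v → large-successors lem {S = S} {v = v} total)
  in R , (λ r → large⇒member lem S-subtree m≤N (R⊆large r)) , R-regular
  where
    total : N ∸ m + 1 + m ≡ suc N
    total = trans (+-assoc (N ∸ m) 1 m) (trans (+-suc (N ∸ m) m) (cong suc (m∸n+n≡m m≤N)))
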